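{- Let $\sigma\in\mathfrak S_n$ and $1\le i\le n$ with $\sigma^{ -1}(i)<n$. Then $\sigma^{ -1}(i)$ is a right-to-left maximum of $\sigma$ (i.e. $i=\max_{l\ge\sigma^{ -1}(i)}\sigma(l)$) if and only if the $i$th step of $\Psi_{FV}(\sigma)$ is a type 2 step and every type 1 step of $\Psi_{FV}(\sigma)$ is to the left of the $i$th step.
   Context: A Laguerre history of size $n$ is a Motzkin path of $n$ steps in which each step carries a weight: a step $\nearrow$ starting at height $h$ has weight $yq^i$ for some $i\in\{0,\dots,h\}$; a step $\rightarrow$ starting at height $h$ has weight either $yq^i$ for some $i\in\{0,\dots,h\}$ or $q^i$ for some $i\in\{0,\dots,h-1\}$; a step $\searrow$ starting at height $h$ has weight $q^i$ for some $i\in\{0,\dots,h-1\}$. A type 1 step has weight $yq^h$ and a type 2 step has weight $q^{h-1}$, where $h$ is its starting height. The Françon–Viennot map $\Psi_{FV}$: for $\sigma\in\mathfrak S_n$, use the conventions $\sigma(0)=0$, $\sigma(n+1)=n+1$. For $j\in\{1,\dots,n\}$ and $k=\sigma(j)$, the $k$th step of $\Psi_{FV}(\sigma)$ is $\nearrow$ if $\sigma(j-1)>\sigma(j)<\sigma(j+1)$, $\searrow$ if $\sigma(j-1)<\sigma(j)>\sigma(j+1)$, and $\rightarrow$ otherwise; its weight is $y^\delta q^m$ where $\delta=1$ if $j$ is an ascent ($j=n$ or $\sigma(j)<\sigma(j+1)$) and $0$ otherwise, and $m$ is the number of $l$ with $1\le l$, $l+1<j$ and $\sigma(l+1)<\sigma(j)<\sigma(l)$.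 -}

module Defs where

open import Data.Nat using (ℕ; zero; suc; _+_; _∸_; _≤_; _<_; _<ᵇ_; _<?_)
open import Data.Bool using (Bool; true; false; _∧_; if_then_else_)
open import Data.Fin using (Fin; toℕ; fromℕ<)
open import Data.Fin.Permutation using (Permutation′; _⟨$⟩ʳ_)
open import Data.Product using (Σ; _×_; ∃)
open import Relation.Nullary using (yes; no)
open import Relation.Binary.PropositionalEquality using (_≡_)

-- One-line notation for positions/values 1..n, with the conventions
-- σ(0) = 0 and σ(n+1) = n+1.  A permutation π : Fin n ↔ Fin n is read
-- as σ(j) = 1 + toℕ (π (j-1)) for 1 ≤ j ≤ n.
σ̂ : {n : ℕ} → Permutation′ n → ℕ → ℕ
σ̂ {n} π zero = zero
σ̂ {n} π (suc j) with j <? n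
... | yes p = suc (toℕ (π ⟨$⟩ʳ fromℕ< p))
... | no _  = suc n

countTo : (ℕ → Bool) → ℕ → ℕ
countTo P zero = zero
countTo P (suc N) = (if P (suc N) then 1 else 0) + countTo P N

data StepKind : Set where
  up down flat : StepKind

-- kind of the step produced by position j (this is step number σ(j))
kind : {n : ℕ} → Permutation′ n → ℕ → StepKind
kind π j with (σ̂ π j <ᵇ σ̂ π (j ∸ 1)) ∧ (σ̂ π j <ᵇ σ̂ π (suc j))
           | (σ̂ π (j ∸ 1) <ᵇ σ̂ π j) ∧ (σ̂ π (suc j) <ᵇ σ̂ π j)
... | true  | _     = up
... | false | true  = down
... | false | false = flat

isUp : StepKind → Bool
isUp up = true
isUp _  = false

isDown : StepKind → Bool
isDown down = true
isDown _    = false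

-- δ: j is an ascent (j = n or σ(j) < σ(j+1)); since σ(n+1) = n+1 this is
-- uniformly σ(j) < σ(j+1) for 1 ≤ j ≤ n
δ : {n : ℕ} → Permutation′ n → ℕ → Bool
δ π j = σ̂ π j <ᵇ σ̂ π (suc j)

mExp : {n : ℕ} → Permutation′ n → ℕ → ℕ
mExp π j = countTo (λ l → (σ̂ π (suc l) <ᵇ σ̂ π j) ∧ (σ̂ π j <ᵇ σ̂ π l)) (j ∸ 2)

-- starting height of step number σ(j): (#up steps before it) − (#down steps before it)
height : {n : ℕ} → Permutation′ n → ℕ → ℕ
height {n} π j =
  countTo (λ j′ → (σ̂ π j′ <ᵇ σ̂ π j) ∧ isUp (kind π j′)) n
  ∸ countTo (λ j′ → (σ̂ π j′ <ᵇ σ̂ π j) ∧ isDown (kind π j′)) n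

-- the k-th step of Ψ_FV(σ) (k = σ(j)) is of type 1: weight y q^h
IsType1 : {n : ℕ} → Permutation′ n → ℕ → Set
IsType1 {n} π k = Σ ℕ λ j → (1 ≤ j) × (j ≤ n) × (σ̂ π j ≡ k)
  × (δ π j ≡ true) × (mExp π j ≡ height π j)

-- the k-th step of Ψ_FV(σ) is of type 2: weight q^(h-1) (requires h ≥ 1)
IsType2 : {n : ℕ} → Permutation′ n → ℕ → Set
IsType2 {n} π k = Σ ℕ λ j → (1 ≤ j) × (j ≤ n) × (σ̂ π j ≡ k)
  × (δ π j ≡ false) × (suc (mExp π j) ≡ height π j)

IsRLMax : {n : ℕ} → Permutation′ n → ℕ → Set
IsRLMax {n} π j = ∀ l → j ≤ l → l ≤ n → σ̂ π l ≤ σ̂ π j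

-- Fix the value v = σ(j).  The starting height of step v counts the up steps
-- minus the down steps among the values below v; walking along positions,
-- this difference grows by one exactly at each "crossing" l, where
-- σ(l) ≥ v > σ(l+1).  Hence the height is the number of crossings of v,
-- while the weight exponent of position j counts the crossings at l ≤ j (the
-- one at l = j being present iff j is a descent).  So j gives a type 1 or a
-- type 2 step iff no crossing of σ(j) occurs after j.  A right-to-left
-- maximum at j < n is a descent with no later crossing, and no type 1 step
-- to its right, since a type 1 step at j′ < j would keep all later values
-- above σ(j′).  Conversely, if some σ(l) > σ(j) with l > j, the position of
-- the minimum of σ on [l, n] is a type 1 step to the right of σ(j).
module Submission where

open import Defs
open import Data.Bool using (Bool; true; false; _∧_; not; if_then_else_)
open import Data.Bool.Properties using (∧-identityʳ; ∧-zeroʳ)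
open import Data.Fin using (toℕ; fromℕ<)
open import Data.Fin.Properties using (toℕ-injective; toℕ-fromℕ<; toℕ<n)
open import Data.Fin.Permutation using (Permutation′; _⟨$⟩ʳ_; _⟨$⟩ˡ_; inverseˡ)
open import Data.Nat using (ℕ; zero; suc; _+_; _∸_; _≤_; _<_; _<ᵇ_; _<?_; _≤?_; z≤n; s≤s)
open import Data.Nat.Properties
open import Data.Nat.Tactic.RingSolver using (solve-∀)
open import Data.Product using (∃-syntax; _×_; _,_)
open import Data.Sum using (inj₁; inj₂)
open import Function using (_∘_)
open import Function.Bundles using (_⇔_; mk⇔; Equivalence)
open import Relation.Binary.Definitions using (tri<; tri≈; tri>)
open import Relation.Binary.PropositionalEquality
open import Relation.Nullary using (¬_; yes; no; contradiction)
open import Relation.Nullary.Reflects using (ofʸ; ofⁿ)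

open Equivalence using (to; from)

iverson : Bool → ℕ
iverson b = if b then 1 else 0

<⇒<ᵇ≡true : ∀ {m n} → m < n → (m <ᵇ n) ≡ true
<⇒<ᵇ≡true {m} {n} m<n with m <ᵇ n | <ᵇ-reflects-< m n
... | true  | _        = refl
... | false | ofⁿ m≮n = contradiction m<n m≮n

≮⇒<ᵇ≡false : ∀ {m n} → ¬ m < n → (m <ᵇ n) ≡ false
≮⇒<ᵇ≡false {m} {n} m≮n with m <ᵇ n | <ᵇ-reflects-< m n
... | true  | ofʸ m<n = contradiction m<n m≮n
... | false | _        = refl

<ᵇ≡true⇒< : ∀ {m n} → (m <ᵇ n) ≡ true → m < n
<ᵇ≡true⇒< {m} {n} eq with m <ᵇ n | <ᵇ-reflects-< m n
<ᵇ≡true⇒< refl | true | ofʸ m<n = m<n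

<ᵇ≡false⇒≮ : ∀ {m n} → (m <ᵇ n) ≡ false → ¬ m < n
<ᵇ≡false⇒≮ {m} {n} eq with m <ᵇ n | <ᵇ-reflects-< m n
<ᵇ≡false⇒≮ refl | false | ofⁿ m≮n = m≮n

<ᵇ-flip : ∀ {m n} → m ≢ n → (n <ᵇ m) ≡ not (m <ᵇ n)
<ᵇ-flip {m} {n} m≢n with <-cmp m n
... | tri< m<n _ n≮m = trans (≮⇒<ᵇ≡false n≮m) (cong not (sym (<⇒<ᵇ≡true m<n)))
... | tri≈ _ m≡n _   = contradiction m≡n m≢n
... | tri> m≮n _ n<m = trans (<⇒<ᵇ≡true n<m) (cong not (sym (≮⇒<ᵇ≡false m≮n)))

interval-induction : ∀ {ℓ} (P : ℕ → Set ℓ) {a b} → a ≤ b → P a →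
  (∀ l → a ≤ l → l < b → P l → P (suc l)) → P b
interval-induction P {b = zero} z≤n Pa step = Pa
interval-induction P {b = suc b} a≤1+b Pa step with m≤n⇒m<n∨m≡n a≤1+b
... | inj₂ refl  = Pa
... | inj₁ a<1+b = step b a≤b (n<1+n b)
  (interval-induction P a≤b Pa (λ l a≤l l<b → step l a≤l (m<n⇒m<1+n l<b)))
  where a≤b = ≤-pred a<1+b

argmin : (f : ℕ → ℕ) {a b : ℕ} → a ≤ b →
  ∃[ q ] a ≤ q × q ≤ b × (∀ m → a ≤ m → m ≤ b → f q ≤ f m)
argmin f {a} a≤b = interval-induction ArgminUpTo a≤b base step
  where
  ArgminUpTo : ℕ → Set
  ArgminUpTo b = ∃[ q ] a ≤ q × q ≤ b × (∀ m → a ≤ m → m ≤ b → f q ≤ f m)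

  base : ArgminUpTo a
  base = a , ≤-refl , ≤-refl , λ m a≤m m≤a → ≤-reflexive (cong f (≤-antisym a≤m m≤a))

  extend : ∀ {c l} → (∀ m → a ≤ m → m ≤ l → c ≤ f m) → c ≤ f (suc l) →
    ∀ m → a ≤ m → m ≤ suc l → c ≤ f m
  extend lower c≤ m a≤m m≤1+l with m≤n⇒m<n∨m≡n m≤1+l
  ... | inj₁ m<1+l = lower m a≤m (≤-pred m<1+l)
  ... | inj₂ refl  = c≤

  step : ∀ l → a ≤ l → l < _ → ArgminUpTo l → ArgminUpTo (suc l)
  step l a≤l _ (q , a≤q , q≤l , minimal) with f q ≤? f (suc l)
  ... | yes fq≤ = q , a≤q , m≤n⇒m≤1+n q≤l , extend minimal fq≤
  ... | no fq≰  = suc l , m≤n⇒m≤1+n a≤l , ≤-refl ,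
    extend (λ m a≤m m≤l → ≤-trans (<⇒≤ (≰⇒> fq≰)) (minimal m a≤m m≤l)) ≤-refl

countTo-cong : ∀ {P Q : ℕ → Bool} N → (∀ l → 1 ≤ l → l ≤ N → P l ≡ Q l) →
  countTo P N ≡ countTo Q N
countTo-cong zero    _   = refl
countTo-cong (suc N) P≗Q = cong₂ (λ b c → iverson b + c) (P≗Q (suc N) (s≤s z≤n) ≤-refl)
  (countTo-cong N (λ l 1≤l l≤N → P≗Q l 1≤l (m≤n⇒m≤1+n l≤N)))

countTo-mono : ∀ P {M N} → M ≤ N → countTo P M ≤ countTo P N
countTo-mono P {M} M≤N = interval-induction (λ N → countTo P M ≤ countTo P N) M≤N ≤-refl
  (λ l _ _ ih → ≤-trans ih (m≤n+m _ _))

countTo-hit : ∀ P {l} → P (suc l) ≡ true → countTo P l < countTo P (suc l)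
countTo-hit P Pl rewrite Pl = ≤-refl

countTo-stable⇔ : ∀ P {M N} → M ≤ N →
  countTo P N ≡ countTo P M ⇔ (∀ l → M < l → l ≤ N → P l ≡ false)
countTo-stable⇔ P {M} {N} M≤N = mk⇔ misses stable
  where
  misses : countTo P N ≡ countTo P M → ∀ l → M < l → l ≤ N → P l ≡ false
  misses eq (suc l) M<1+l 1+l≤N with P (suc l) in Pl
  ... | false = refl
  ... | true  = contradiction eq (>⇒≢ (begin-strict
    countTo P M        ≤⟨ countTo-mono P (≤-pred M<1+l) ⟩
    countTo P l        <⟨ countTo-hit P Pl ⟩
    countTo P (suc l)  ≤⟨ countTo-mono P 1+l≤N ⟩
    countTo P N        ∎))
    where open ≤-Reasoning

  stable : (∀ l → M < l → l ≤ N → P l ≡ false) → countTo P N ≡ countTo P M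
  stable none = interval-induction (λ N′ → countTo P N′ ≡ countTo P M) M≤N refl
    (λ l M≤l l<N ih → trans (cong (λ b → iverson b + countTo P l) (none (suc l) (s≤s M≤l) l<N)) ih)

-- With x, y, z = σ(N), σ(N+1), σ(N+2), the step at N+1 changes
-- ups − downs − crossings (below v) by d − d′, where d and d′ flag a descent
-- to a value below v from x to y and from y to z.
local-balance : ∀ {x y z v} → x ≢ y → y ≢ z →
    iverson ((y <ᵇ v) ∧ ((y <ᵇ x) ∧ (y <ᵇ z))) + iverson ((z <ᵇ y) ∧ (z <ᵇ v))
  ≡ iverson ((y <ᵇ v) ∧ (not ((y <ᵇ x) ∧ (y <ᵇ z)) ∧ ((x <ᵇ y) ∧ (z <ᵇ y))))
    + iverson ((z <ᵇ v) ∧ not (y <ᵇ v)) + iverson ((y <ᵇ x) ∧ (y <ᵇ v))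
local-balance {x} {y} {z} {v} x≢y y≢z
  rewrite <ᵇ-flip {y} {x} (x≢y ∘ sym) | <ᵇ-flip {y} {z} y≢z =
  table (y <ᵇ x) (y <ᵇ z) (y <ᵇ v) (z <ᵇ v) z<y<v z<v≤y
  where
  z<y<v : (y <ᵇ v) ≡ true → (y <ᵇ z) ≡ false → (z <ᵇ v) ≡ true
  z<y<v y<v y≮z = <⇒<ᵇ≡true (<-trans (≤∧≢⇒< (≮⇒≥ (<ᵇ≡false⇒≮ {y} {z} y≮z)) (y≢z ∘ sym)) (<ᵇ≡true⇒< {y} {v} y<v))

  z<v≤y : (y <ᵇ v) ≡ false → (z <ᵇ v) ≡ true → (y <ᵇ z) ≡ false
  z<v≤y y≮v z<v = ≮⇒<ᵇ≡false (λ y<z → <ᵇ≡false⇒≮ {y} {v} y≮v (<-trans y<z (<ᵇ≡true⇒< {z} {v} z<v)))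

  table : ∀ a b yv zv → (yv ≡ true → b ≡ false → zv ≡ true) → (yv ≡ false → zv ≡ true → b ≡ false) →
      iverson (yv ∧ (a ∧ b)) + iverson (not b ∧ zv)
    ≡ iverson (yv ∧ (not (a ∧ b) ∧ (not a ∧ not b))) + iverson (zv ∧ not yv) + iverson (a ∧ yv)
  table true  true  true  true  _ _ = refl
  table true  true  true  false _ _ = refl
  table true  true  false true  _ c with () ← c refl refl
  table true  true  false false _ _ = refl
  table true  false true  true  _ _ = refl
  table true  false true  false c _ with () ← c refl refl
  table true  false false true  _ _ = refl
  table true  false false false _ _ = refl
  table false true  true  true  _ _ = refl
  table false true  true  false _ _ = refl
  table false true  false true  _ c with () ← c refl refl
  table false true  false false _ _ = refl
  table false false true  true  _ _ = refl
  table false false true  false c _ with () ← c refl refl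
  table false false false true  _ _ = refl
  table false false false false _ _ = refl

balance-step : ∀ U d′ D X d u w c → U + d′ ≡ D + X + d → u + d ≡ w + c →
  U + u + d′ ≡ D + w + (X + c)
balance-step U d′ D X d u w c local ih = begin
  U + u + d′       ≡⟨ swap-left U u d′ ⟩
  u + (U + d′)     ≡⟨ cong (u +_) local ⟩
  u + (D + X + d)  ≡⟨ +-comm-assoc u (D + X) d ⟩
  D + X + (u + d)  ≡⟨ cong (D + X +_) ih ⟩
  D + X + (w + c)  ≡⟨ interchange D X w c ⟩
  D + w + (X + c)  ∎
  where
  swap-left : ∀ a b e → a + b + e ≡ b + (a + e)
  swap-left = solve-∀
  +-comm-assoc : ∀ a b e → a + (b + e) ≡ b + (a + e)
  +-comm-assoc = solve-∀
  interchange : ∀ a b e f → a + b + (e + f) ≡ a + e + (b + f)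
  interchange = solve-∀
  open ≡-Reasoning

module _ {n : ℕ} (π : Permutation′ n) where

  σ : ℕ → ℕ
  σ = σ̂ π

  σ̂-top : σ (suc n) ≡ suc n
  σ̂-top with n <? n
  ... | yes n<n = contradiction n<n (n≮n n)
  ... | no _    = refl

  σ̂-≤ : ∀ {j} → j ≤ n → σ j ≤ n
  σ̂-≤ {zero}  _     = z≤n
  σ̂-≤ {suc j} 1+j≤n with j <? n
  ... | yes _   = toℕ<n _
  ... | no j≮n = contradiction 1+j≤n j≮n

  σ̂-positive : ∀ {j} → 1 ≤ j → 1 ≤ σ j
  σ̂-positive {suc j} _ with j <? n
  ... | yes _ = s≤s z≤n
  ... | no _  = s≤s z≤n

  σ̂-injective : ∀ {a b} → a ≤ suc n → b ≤ suc n → σ a ≡ σ b → a ≡ b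
  σ̂-injective {zero}  {zero}  _ _ _  = refl
  σ̂-injective {zero}  {suc b} _ _ eq = contradiction eq (<⇒≢ (σ̂-positive {suc b} (s≤s z≤n)))
  σ̂-injective {suc a} {zero}  _ _ eq = contradiction (sym eq) (<⇒≢ (σ̂-positive {suc a} (s≤s z≤n)))
  σ̂-injective {suc a} {suc b} 1+a≤ 1+b≤ eq with a <? n | b <? n
  ... | yes a<n | yes b<n = cong suc (begin
    a                                ≡⟨ toℕ-fromℕ< a<n ⟨
    toℕ (fromℕ< a<n)                 ≡⟨ cong toℕ (permutation-injective (toℕ-injective (suc-injective eq))) ⟩
    toℕ (fromℕ< b<n)                 ≡⟨ toℕ-fromℕ< b<n ⟩
    b                                ∎)
    where
    permutation-injective : ∀ {i k} → π ⟨$⟩ʳ i ≡ π ⟨$⟩ʳ k → i ≡ k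
    permutation-injective {i} {k} πi≡πk =
      trans (sym (inverseˡ π)) (trans (cong (π ⟨$⟩ˡ_) πi≡πk) (inverseˡ π))
    open ≡-Reasoning
  ... | yes a<n | no b≮n  = contradiction (suc-injective eq) (<⇒≢ (toℕ<n _))
  ... | no a≮n  | yes b<n = contradiction (suc-injective (sym eq)) (<⇒≢ (toℕ<n _))
  ... | no a≮n  | no b≮n  =
    cong suc (trans (≤-antisym (≤-pred 1+a≤) (≮⇒≥ a≮n)) (≤-antisym (≮⇒≥ b≮n) (≤-pred 1+b≤)))

  σ̂-≢ : ∀ {a b} → a ≤ suc n → b ≤ suc n → a ≢ b → σ a ≢ σ b
  σ̂-≢ a≤ b≤ a≢b = a≢b ∘ σ̂-injective a≤ b≤

  isUp-kind : ∀ p → isUp (kind π p) ≡ (σ p <ᵇ σ (p ∸ 1)) ∧ (σ p <ᵇ σ (suc p))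
  isUp-kind p with (σ p <ᵇ σ (p ∸ 1)) ∧ (σ p <ᵇ σ (suc p)) | (σ (p ∸ 1) <ᵇ σ p) ∧ (σ (suc p) <ᵇ σ p)
  ... | true  | _     = refl
  ... | false | true  = refl
  ... | false | false = refl

  isDown-kind : ∀ p → isDown (kind π p) ≡
    not ((σ p <ᵇ σ (p ∸ 1)) ∧ (σ p <ᵇ σ (suc p))) ∧ ((σ (p ∸ 1) <ᵇ σ p) ∧ (σ (suc p) <ᵇ σ p))
  isDown-kind p with (σ p <ᵇ σ (p ∸ 1)) ∧ (σ p <ᵇ σ (suc p)) | (σ (p ∸ 1) <ᵇ σ p) ∧ (σ (suc p) <ᵇ σ p)
  ... | true  | _     = refl
  ... | false | true  = refl
  ... | false | false = refl

  ups downs crossings : ℕ → ℕ → ℕ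
  ups   v N = countTo (λ p → (σ p <ᵇ v) ∧ isUp (kind π p)) N
  downs v N = countTo (λ p → (σ p <ᵇ v) ∧ isDown (kind π p)) N

  crossing : ℕ → ℕ → Bool
  crossing v l = (σ (suc l) <ᵇ v) ∧ not (σ l <ᵇ v)

  crossings v N = countTo (crossing v) N

  descendsBelow : ℕ → ℕ → Bool
  descendsBelow v N = (σ (suc N) <ᵇ σ N) ∧ (σ (suc N) <ᵇ v)

  ups+descent≡downs+crossings : ∀ v N → N ≤ n →
    ups v N + iverson (descendsBelow v N) ≡ downs v N + crossings v N
  ups+descent≡downs+crossings v zero    _     = refl
  ups+descent≡downs+crossings v (suc N) 1+N≤n =
    balance-step upStep (iverson (descendsBelow v (suc N))) downStep (iverson (crossing v (suc N)))
      (iverson (descendsBelow v N)) (ups v N) (downs v N) (crossings v N)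
      local (ups+descent≡downs+crossings v N (≤-trans (n≤1+n N) 1+N≤n))
    where
    upStep downStep : ℕ
    upStep   = iverson ((σ (suc N) <ᵇ v) ∧ isUp (kind π (suc N)))
    downStep = iverson ((σ (suc N) <ᵇ v) ∧ isDown (kind π (suc N)))
    local : iverson ((σ (suc N) <ᵇ v) ∧ isUp (kind π (suc N))) + iverson (descendsBelow v (suc N))
          ≡ iverson ((σ (suc N) <ᵇ v) ∧ isDown (kind π (suc N))) + iverson (crossing v (suc N))
            + iverson (descendsBelow v N)
    local rewrite isUp-kind (suc N) | isDown-kind (suc N) =
      local-balance {v = v} (σ̂-≢ (m≤n⇒m≤1+n (≤-trans (n≤1+n N) 1+N≤n)) (m≤n⇒m≤1+n 1+N≤n) (<⇒≢ (n<1+n N)))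
                    (σ̂-≢ (m≤n⇒m≤1+n 1+N≤n) (s≤s 1+N≤n) (<⇒≢ (n<1+n (suc N))))

  height≡crossings : ∀ {j} → j ≤ n → height π j ≡ crossings (σ j) n
  height≡crossings {j} j≤n = begin
    ups v n ∸ downs v n                  ≡⟨ cong (_∸ downs v n) ups≡ ⟩
    downs v n + crossings v n ∸ downs v n ≡⟨ m+n∸m≡n (downs v n) (crossings v n) ⟩
    crossings v n                        ∎
    where
    open ≡-Reasoning
    v = σ j
    no-final-descent : (σ (suc n) <ᵇ σ n) ≡ false
    no-final-descent rewrite σ̂-top = ≮⇒<ᵇ≡false (≤⇒≯ (m≤n⇒m≤1+n (σ̂-≤ ≤-refl)))
    ups≡ : ups v n ≡ downs v n + crossings v n
    ups≡ = trans (sym (+-identityʳ _))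
      (subst (λ b → ups v n + iverson (b ∧ (σ (suc n) <ᵇ v)) ≡ downs v n + crossings v n)
             no-final-descent (ups+descent≡downs+crossings v n ≤-refl))

  crossing-at-self : ∀ {j} → j ≤ n → crossing (σ j) j ≡ not (δ π j)
  crossing-at-self {j} j≤n rewrite ≮⇒<ᵇ≡false (n≮n (σ j)) =
    trans (∧-identityʳ _) (<ᵇ-flip (σ̂-≢ (m≤n⇒m≤1+n j≤n) (s≤s j≤n) (<⇒≢ (n<1+n j))))

  crossings-before : ∀ m → suc m ≤ n → crossings (σ (suc m)) m ≡ mExp π (suc m)
  crossings-before zero    _     = refl
  crossings-before (suc m) 2+m≤n rewrite ≮⇒<ᵇ≡false (n≮n (σ (suc (suc m)))) =
    countTo-cong m λ l _ l≤m → cong ((σ (suc l) <ᵇ σ (suc (suc m))) ∧_)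
      (sym (<ᵇ-flip (σ̂-≢ (<⇒≤ (<-≤-trans (l<j l≤m) j≤1+n)) j≤1+n (<⇒≢ (l<j l≤m)))))
    where
    j≤1+n = m≤n⇒m≤1+n 2+m≤n
    l<j : ∀ {l} → l ≤ m → l < suc (suc m)
    l<j l≤m = m<n⇒m<1+n (s≤s l≤m)

  crossings-upto : ∀ {j} → 1 ≤ j → j ≤ n → crossings (σ j) j ≡ iverson (not (δ π j)) + mExp π j
  crossings-upto {suc m} _ j≤n =
    cong₂ (λ b c → iverson b + c) (crossing-at-self j≤n) (crossings-before m j≤n)

  NoCrossingAfter : ℕ → Set
  NoCrossingAfter j = ∀ l → j < l → l ≤ n → σ j ≤ σ l → σ j ≤ σ (suc l)

  crossing≡false⇔ : ∀ {v l} → crossing v l ≡ false ⇔ (v ≤ σ l → v ≤ σ (suc l))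
  crossing≡false⇔ {v} {l} = mk⇔ stays-above no-crossing
    where
    stays-above : crossing v l ≡ false → v ≤ σ l → v ≤ σ (suc l)
    stays-above none v≤σl = ≮⇒≥ λ σ′<v →
      contradiction (trans (sym (cong₂ (λ a b → a ∧ not b) (<⇒<ᵇ≡true σ′<v) (≮⇒<ᵇ≡false (≤⇒≯ v≤σl)))) none)
                    λ ()
    no-crossing : (v ≤ σ l → v ≤ σ (suc l)) → crossing v l ≡ false
    no-crossing f with σ l <? v
    ... | yes σl<v = trans (cong (λ b → (σ (suc l) <ᵇ v) ∧ not b) (<⇒<ᵇ≡true σl<v)) (∧-zeroʳ _)
    ... | no σl≮v  = cong (_∧ not (σ l <ᵇ v)) (≮⇒<ᵇ≡false (≤⇒≯ (f (≮⇒≥ σl≮v))))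

  -- Type 1 is the case b = true, type 2 the case b = false.
  exponent≡height⇔noCrossingAfter : ∀ {j b} → 1 ≤ j → j ≤ n → δ π j ≡ b →
    iverson (not b) + mExp π j ≡ height π j ⇔ NoCrossingAfter j
  exponent≡height⇔noCrossingAfter {j} {b} 1≤j j≤n δ≡b = mk⇔
    (λ e l j<l l≤n → to crossing≡false⇔ (to stable (trans (sym height≡) (trans (sym e) exponent≡)) l j<l l≤n))
    (λ nc → trans exponent≡ (trans (sym (from stable λ l j<l l≤n → from crossing≡false⇔ (nc l j<l l≤n)))
                                   (sym height≡)))
    where
    stable = countTo-stable⇔ (crossing (σ j)) j≤n
    height≡ = height≡crossings j≤n
    exponent≡ : iverson (not b) + mExp π j ≡ crossings (σ j) j
    exponent≡ = trans (cong (λ b → iverson (not b) + mExp π j) (sym δ≡b)) (sym (crossings-upto 1≤j j≤n))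

  noCrossingAfter⇒stays-above : ∀ {j a b} → NoCrossingAfter j → j < a → a ≤ b → b ≤ n →
    σ j ≤ σ a → σ j ≤ σ b
  noCrossingAfter⇒stays-above {j} nc j<a a≤b b≤n σj≤σa =
    interval-induction (λ m → σ j ≤ σ m) a≤b σj≤σa
      (λ l a≤l l<b → nc l (<-≤-trans j<a a≤l) (≤-trans (<⇒≤ l<b) b≤n))

  rlMax⇒descent : ∀ {j} → j < n → IsRLMax π j → δ π j ≡ false
  rlMax⇒descent {j} j<n rl = ≮⇒<ᵇ≡false (<⇒≯ (≤∧≢⇒< (rl (suc j) (n≤1+n j) j<n)
    (σ̂-≢ (m≤n⇒m≤1+n j<n) (m≤n⇒m≤1+n (<⇒≤ j<n)) (>⇒≢ (n<1+n j)))))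

  rlMax⇒noCrossingAfter : ∀ {j} → j ≤ n → IsRLMax π j → NoCrossingAfter j
  rlMax⇒noCrossingAfter j≤n rl l j<l l≤n σj≤σl =
    contradiction (σ̂-injective (m≤n⇒m≤1+n l≤n) (m≤n⇒m≤1+n j≤n) (≤-antisym (rl l (<⇒≤ j<l) l≤n) σj≤σl))
                  (>⇒≢ j<l)

  rlMax⇒type2 : ∀ {j} → 1 ≤ j → j < n → IsRLMax π j → IsType2 π (σ j)
  rlMax⇒type2 1≤j j<n rl = _ , 1≤j , <⇒≤ j<n , refl , descent ,
    from (exponent≡height⇔noCrossingAfter 1≤j (<⇒≤ j<n) descent) (rlMax⇒noCrossingAfter (<⇒≤ j<n) rl)
    where descent = rlMax⇒descent j<n rl

  -- A type 1 step at j′ < j has no later crossing of σ(j′), so σ(j) ≥ σ(j′).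
  rlMax⇒type1-below : ∀ {j} → j < n → IsRLMax π j →
    ∀ k → 1 ≤ k → k ≤ n → IsType1 π k → k < σ j
  rlMax⇒type1-below {j} j<n rl _ _ _ (j′ , 1≤j′ , j′≤n , refl , ascent , exponent≡) =
    ≤∧≢⇒< σj′≤σj (σ̂-≢ (m≤n⇒m≤1+n j′≤n) (m≤n⇒m≤1+n (<⇒≤ j<n)) j′≢j)
    where
    j′≢j : j′ ≢ j
    j′≢j refl with () ← trans (sym ascent) (rlMax⇒descent j<n rl)
    σj′≤σj : σ j′ ≤ σ j
    σj′≤σj with j ≤? j′
    ... | yes j≤j′ = rl j′ j≤j′ j′≤n
    ... | no j≰j′  = noCrossingAfter⇒stays-above
      (to (exponent≡height⇔noCrossingAfter 1≤j′ j′≤n ascent) exponent≡)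
      ≤-refl (≰⇒> j≰j′) (<⇒≤ j<n) (<⇒≤ (<ᵇ≡true⇒< ascent))

  type1-in-suffix : ∀ {l} → 1 ≤ l → l ≤ n → ∃[ q ] l ≤ q × q ≤ n × IsType1 π (σ q)
  type1-in-suffix {l} 1≤l l≤n with argmin σ l≤n
  ... | q , l≤q , q≤n , minimal =
    q , l≤q , q≤n , q , 1≤q , q≤n , refl , ascent , from (exponent≡height⇔noCrossingAfter 1≤q q≤n ascent) noCrossing
    where
    1≤q = ≤-trans 1≤l l≤q
    -- σ(n+1) = n+1 exceeds every value, so q stays minimal on [l, n+1].
    minimal⁺ : ∀ m → l ≤ m → m ≤ suc n → σ q ≤ σ m
    minimal⁺ m l≤m m≤1+n with m≤n⇒m<n∨m≡n m≤1+n
    ... | inj₁ m<1+n = minimal m l≤m (≤-pred m<1+n)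
    ... | inj₂ refl  = ≤-trans (m≤n⇒m≤1+n (σ̂-≤ q≤n)) (≤-reflexive (sym σ̂-top))
    ascent : δ π q ≡ true
    ascent = <⇒<ᵇ≡true (≤∧≢⇒< (minimal⁺ (suc q) (m≤n⇒m≤1+n l≤q) (s≤s q≤n))
      (σ̂-≢ (m≤n⇒m≤1+n q≤n) (s≤s q≤n) (<⇒≢ (n<1+n q))))
    noCrossing : NoCrossingAfter q
    noCrossing m q<m m≤n _ = minimal⁺ (suc m) (m≤n⇒m≤1+n (≤-trans l≤q (<⇒≤ q<m))) (s≤s m≤n)

  noCrossingAfter⇒type1-above : ∀ {j l} → j ≤ n → NoCrossingAfter j → j < l → l ≤ n → σ j < σ l →
    ∃[ k ] 1 ≤ k × k ≤ n × σ j < k × IsType1 π k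
  noCrossingAfter⇒type1-above {j} {l} j≤n noCrossing j<l l≤n σj<σl
    with type1-in-suffix (≤-trans (s≤s z≤n) j<l) l≤n
  ... | q , l≤q , q≤n , type1 = σ q , σ̂-positive 1≤q , σ̂-≤ q≤n , σj<σq , type1
    where
    1≤q = ≤-trans (s≤s z≤n) (<-≤-trans j<l l≤q)
    σj<σq : σ j < σ q
    σj<σq = ≤∧≢⇒< (noCrossingAfter⇒stays-above noCrossing j<l l≤q q≤n (<⇒≤ σj<σl))
      (σ̂-≢ (m≤n⇒m≤1+n j≤n) (m≤n⇒m≤1+n q≤n) (<⇒≢ (<-≤-trans j<l l≤q)))

  type2∧type1-below⇒rlMax : ∀ {j} → j ≤ n → IsType2 π (σ j) →
    (∀ k → 1 ≤ k → k ≤ n → IsType1 π k → k < σ j) → IsRLMax π j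
  type2∧type1-below⇒rlMax {j} j≤n (j″ , 1≤j″ , j″≤n , σj″≡σj , descent , exponent≡) below l j≤l l≤n =
    ≮⇒≥ no-higher-value
    where
    noCrossing : NoCrossingAfter j
    noCrossing = subst NoCrossingAfter (σ̂-injective (m≤n⇒m≤1+n j″≤n) (m≤n⇒m≤1+n j≤n) σj″≡σj)
      (to (exponent≡height⇔noCrossingAfter 1≤j″ j″≤n descent) exponent≡)
    j<l : σ j < σ l → j < l
    j<l σj<σl = ≤∧≢⇒< j≤l λ { refl → <-irrefl refl σj<σl }
    no-higher-value : ¬ σ j < σ l
    no-higher-value σj<σl with noCrossingAfter⇒type1-above j≤n noCrossing (j<l σj<σl) l≤n σj<σl
    ... | k , 1≤k , k≤n , σj<k , type1 = <⇒≯ σj<k (below k 1≤k k≤n type1)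

lemma3p11 : (n : ℕ) (π : Permutation′ n) (i j : ℕ) → 1 ≤ i → i ≤ n →
    1 ≤ j → j < n → σ̂ π j ≡ i →
    (IsRLMax π j ⇔ (IsType2 π i × (∀ k → 1 ≤ k → k ≤ n → IsType1 π k → k < i)))
lemma3p11 n π _ j _ _ 1≤j j<n refl = mk⇔
  (λ rl → rlMax⇒type2 π 1≤j j<n rl , rlMax⇒type1-below π j<n rl)
  (λ (type2 , below) → type2∧type1-below⇒rlMax π (<⇒≤ j<n) type2 below)
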